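{- Let $S_k^p$ be a generalized sunlet graph. If $k$ is odd and $p$ is even, then $S_k^p$ has a canonical ESD labeling.
   Context: For $k\ge 3$ and $p\ge 1$, the generalized sunlet graph $S_k^p$ is the unicyclic graph obtained from a cycle $C_k$ with vertices $c_1,\dots,c_k$ by attaching, for each $i\in\{1,\dots,k\}$, a path $R_i$ on $p$ vertices so that one endpoint of $R_i$ is identified with $c_i$ (the paths are otherwise disjoint). For a graph $G=(V,E)$ and $l\in\mathbb N$, a vertex labeling $\phi:V\to\{1,\dots,l\}$ is an edge-sum distinguishing (ESD) labeling if $\phi$ is injective and the edge-weights $w_\phi(uv)=\phi(u)+\phi(v)$ are pairwise distinct over all edges $uv\in E$. It is a canonical ESD labeling if $l=|V|$. -}

module Defs where

open import Data.Nat using (ℕ; suc; _+_; _*_; _≤_)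
open import Data.Nat.DivMod using (_%_; m%n<n)
open import Data.Fin using (Fin; toℕ; fromℕ<; inject₁) renaming (suc to fsuc; zero to fzero)
open import Data.Product using (_×_; _,_; ∃)
open import Function.Definitions using (Injective)
open import Relation.Binary.PropositionalEquality using (_≡_)

-- A finite graph presented by a vertex type, an edge type (each edge of the
-- graph represented exactly once), and the endpoint map.
record Graph : Set₁ where
  field
    V    : Set
    E    : Set
    ends : E → V × V

open Graph public

-- Edges of S_k^p where k = suc k' and p = suc q.
data SunletEdge (k' q : ℕ) : Set where
  -- cycle edge c_i c_{(i+1) mod k}
  cyc  : Fin (suc k') → SunletEdge k' q
  -- path edge between the j-th and (j+1)-th vertices of R_i, j = 0,…,p-2
  path : Fin (suc k') → Fin q → SunletEdge k' q

sucMod : ∀ {k'} → Fin (suc k') → Fin (suc k')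
sucMod {k'} i = fromℕ< (m%n<n (suc (toℕ i)) (suc k'))

-- Generalized sunlet graph S_k^p with k = suc k', p = suc q.
-- Vertex (i , j) : Fin k × Fin p is the j-th vertex of the path R_i
-- (j = 0 is the endpoint identified with the cycle vertex c_i).
Sunlet : (k' q : ℕ) → Graph
Sunlet k' q = record
  { V    = Fin (suc k') × Fin (suc q)
  ; E    = SunletEdge k' q
  ; ends = λ { (cyc i)    → (i , fzero) , (sucMod i , fzero)
             ; (path i j) → (i , inject₁ j) , (i , fsuc j) }
  }

record IsESD (G : Graph) (l : ℕ) (φ : V G → ℕ) : Set where
  field
    range     : ∀ v → 1 ≤ φ v × φ v ≤ l
    injective : Injective _≡_ _≡_ φ
    distinct  : Injective _≡_ _≡_ (λ e → let (u , v) = ends G e in φ u + φ v)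

-- canonical: l = |V|; for S_k^p, |V| = k * p
HasCanonicalESDSunlet : (k' q : ℕ) → Set
HasCanonicalESDSunlet k' q =
  ∃ λ (φ : V (Sunlet k' q) → ℕ) → IsESD (Sunlet k' q) (suc k' * suc q) φ

Even : ℕ → Set
Even n = ∃ λ m → n ≡ 2 * m

Odd : ℕ → Set
Odd n = ∃ λ m → n ≡ suc (2 * m)

module Submission where

-- Label the vertices row by row: the j-th vertex of the path R_i gets
-- 1 + p·i + j, which is Fin's `combine i j` shifted by one; this is a
-- bijection onto {1,…,kp}, so range and injectivity are immediate.
--
-- A path edge joins labels x and x+1, so its weight 2x+1 is
-- odd and determines the edge.  A cycle edge c_i c_{i+1} has weight
-- 2 + p·s(i) with s(i) = i + (i+1 mod k); it is even because p is even.
-- Hence path and cycle weights never collide, and distinct cycle edges get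
-- distinct weights as soon as s is injective.  Now s(i) = 2i+1 is odd for
-- i < k-1, while s(k-1) = k-1 is even because k is odd; so s is injective.

open import Defs
open import Data.Nat using (ℕ; suc; _≤_; _+_; _*_; z≤n; s≤s)
open import Data.Nat.Properties
  using (suc-injective; +-suc; +-identityʳ; *-cancelˡ-≡; even≢odd; m≤n⇒m<n∨m≡n)
open import Data.Nat.DivMod using (_%_; m<n⇒m%n≡m; n%n≡0)
open import Data.Nat.Tactic.RingSolver using (solve-∀)
open import Data.Fin using (Fin; toℕ; inject₁; combine) renaming (suc to fsuc; zero to fzero)
open import Data.Fin.Properties
  using (toℕ-fromℕ<; toℕ-inject₁; toℕ-injective; toℕ<n; toℕ≤pred[n]; toℕ-combine;
         combine-injective; inject₁-injective)
open import Data.Product using (_×_; _,_)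
open import Data.Product.Properties using (,-injectiveˡ; ,-injectiveʳ)
open import Data.Sum using (_⊎_; inj₁; inj₂)
open import Data.Empty using (⊥-elim)
open import Function.Definitions using (Injective)
open import Relation.Binary.PropositionalEquality
  using (_≡_; refl; sym; trans; cong; cong₂; module ≡-Reasoning)

label : ∀ {k' q} → Fin (suc k') × Fin (suc q) → ℕ
label (i , j) = suc (toℕ (combine i j))

-- `combine` is a bijection Fin k × Fin p → Fin (k·p), so the labels are
-- exactly 1,…,kp: they lie in range and are pairwise distinct.
label-range : ∀ {k' q} (v : Fin (suc k') × Fin (suc q)) →
              1 ≤ label v × label v ≤ suc k' * suc q
label-range (i , j) = s≤s z≤n , toℕ<n (combine i j)

label-injective : ∀ {k' q} → Injective _≡_ _≡_ (label {k'} {q})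
label-injective {x = i , j} {y = i' , j'} eq
  with combine-injective i j i' j' (toℕ-injective (suc-injective eq))
... | refl , refl = refl

weight : ∀ {k' q} → SunletEdge k' q → ℕ
weight {k'} {q} e = let (u , v) = ends (Sunlet k' q) e in label u + label v

-- Consecutive vertices on a path carry consecutive labels, so a path edge
-- has the odd weight 2x + 1, where x is the label of its lower endpoint.
path-weight : ∀ {k' q} (i : Fin (suc k')) (j : Fin q) →
              weight (path i j) ≡ suc (2 * label (i , inject₁ j))
path-weight {q = q} i j = begin
  label (i , inject₁ j) + label (i , fsuc j) ≡⟨ cong (λ x → label (i , inject₁ j) + x) next-label ⟩
  x + suc x                                  ≡⟨ x+suc[x] x ⟩
  suc (2 * x)                                ∎
  where
  open ≡-Reasoning
  x : ℕ
  x = label (i , inject₁ j)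

  next-label : label (i , fsuc j) ≡ suc x
  next-label = begin
    suc (toℕ (combine i (fsuc j)))          ≡⟨ cong suc (toℕ-combine i (fsuc j)) ⟩
    suc (suc q * toℕ i + suc (toℕ j))       ≡⟨ cong suc (+-suc (suc q * toℕ i) (toℕ j)) ⟩
    suc (suc (suc q * toℕ i + toℕ j))       ≡⟨ cong (λ t → suc (suc (suc q * toℕ i + t))) (toℕ-inject₁ j) ⟨
    suc (suc (suc q * toℕ i + toℕ (inject₁ j))) ≡⟨ cong (λ t → suc (suc t)) (toℕ-combine i (inject₁ j)) ⟨
    suc x                                   ∎

  x+suc[x] : ∀ y → y + suc y ≡ suc (2 * y)
  x+suc[x] = solve-∀

cycleSum : ∀ {k'} → Fin (suc k') → ℕ
cycleSum i = toℕ i + toℕ (sucMod i)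

cycle-weight : ∀ {k' q} (i : Fin (suc k')) → weight {q = q} (cyc i) ≡ 2 + suc q * cycleSum i
cycle-weight {q = q} i = begin
  suc (toℕ (combine i fzero)) + suc (toℕ (combine (sucMod i) fzero))
    ≡⟨ cong₂ (λ a b → suc a + suc b) (toℕ-combine i fzero) (toℕ-combine (sucMod i) fzero) ⟩
  suc (suc q * toℕ i + 0) + suc (suc q * toℕ (sucMod i) + 0)
    ≡⟨ distribute (suc q) (toℕ i) (toℕ (sucMod i)) ⟩
  2 + suc q * cycleSum i ∎
  where
  open ≡-Reasoning
  distribute : ∀ p a b → suc (p * a + 0) + suc (p * b + 0) ≡ 2 + p * (a + b)
  distribute = solve-∀

cycle-weight-even : ∀ {k' q m'} → suc q ≡ 2 * m' → (i : Fin (suc k')) →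
                    weight {q = q} (cyc i) ≡ 2 * suc (m' * cycleSum i)
cycle-weight-even {q = q} {m' = m'} p≡2m' i = begin
  weight (cyc i)               ≡⟨ cycle-weight i ⟩
  2 + suc q * cycleSum i       ≡⟨ cong (λ p → 2 + p * cycleSum i) p≡2m' ⟩
  2 + 2 * m' * cycleSum i      ≡⟨ halve m' (cycleSum i) ⟩
  2 * suc (m' * cycleSum i)    ∎
  where
  open ≡-Reasoning
  halve : ∀ m s → 2 + 2 * m * s ≡ 2 * suc (m * s)
  halve = solve-∀

-- On a cycle of length k = k' + 1, s(i) = 2i + 1 except at the last index
-- i = k', where the successor wraps around to 0 and s(k') = k'.
cycleSum-cases : ∀ {k'} (i : Fin (suc k')) →
                 cycleSum i ≡ suc (2 * toℕ i) ⊎ (toℕ i ≡ k' × cycleSum i ≡ k')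
cycleSum-cases {k'} i with m≤n⇒m<n∨m≡n (toℕ≤pred[n] i)
... | inj₁ i<k' = inj₁ (begin
  toℕ i + toℕ (sucMod i)    ≡⟨ cong (toℕ i +_) (trans (toℕ-fromℕ< _) (m<n⇒m%n≡m (s≤s i<k'))) ⟩
  toℕ i + suc (toℕ i)       ≡⟨ +-suc (toℕ i) (toℕ i) ⟩
  suc (toℕ i + toℕ i)       ≡⟨ cong (λ t → suc (toℕ i + t)) (+-identityʳ (toℕ i)) ⟨
  suc (2 * toℕ i)           ∎)
  where open ≡-Reasoning
... | inj₂ i≡k' = inj₂ (i≡k' , (begin
  toℕ i + toℕ (sucMod i)    ≡⟨ cong (toℕ i +_) (toℕ-fromℕ< _) ⟩
  toℕ i + suc (toℕ i) % suc k' ≡⟨ cong (λ t → toℕ i + suc t % suc k') i≡k' ⟩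
  toℕ i + suc k' % suc k'   ≡⟨ cong (toℕ i +_) (n%n≡0 (suc k')) ⟩
  toℕ i + 0                 ≡⟨ +-identityʳ (toℕ i) ⟩
  toℕ i                     ≡⟨ i≡k' ⟩
  k'                        ∎))
  where open ≡-Reasoning

-- On an odd cycle s is injective: the wrap-around value k' = k - 1 is even,
-- while all other values 2i + 1 are odd and pairwise distinct.
cycleSum-injective : ∀ {k'} → Odd (suc k') → Injective _≡_ _≡_ (cycleSum {k'})
cycleSum-injective (m , k≡2m+1) {i} {i'} s≡ with cycleSum-cases i | cycleSum-cases i'
... | inj₁ si | inj₁ si' =
  toℕ-injective (*-cancelˡ-≡ (toℕ i) (toℕ i') 2 (suc-injective (trans (sym si) (trans s≡ si'))))
... | inj₂ (i≡k' , _) | inj₂ (i'≡k' , _) = toℕ-injective (trans i≡k' (sym i'≡k'))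
... | inj₁ si | inj₂ (_ , si') =
  ⊥-elim (even≢odd m (toℕ i) (trans (sym (suc-injective k≡2m+1)) (trans (sym si') (trans (sym s≡) si))))
... | inj₂ (_ , si) | inj₁ si' =
  ⊥-elim (even≢odd m (toℕ i') (trans (sym (suc-injective k≡2m+1)) (trans (sym si) (trans s≡ si'))))

-- For k odd and p even the row-major labeling distinguishes all edge weights:
-- path weights are odd, cycle weights even, and each kind is injective.
weight-injective : ∀ {k' q} → Odd (suc k') → Even (suc q) → Injective _≡_ _≡_ (weight {k'} {q})
weight-injective {q = q} k-odd _ {cyc i} {cyc i'} eq =
  cong cyc (cycleSum-injective k-odd (*-cancelˡ-≡ _ _ (suc q) (suc-injective (suc-injective
    (trans (sym (cycle-weight i)) (trans eq (cycle-weight i')))))))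
weight-injective _ (m' , p≡2m') {cyc i} {path i' j'} eq =
  ⊥-elim (even≢odd (suc (m' * cycleSum i)) (label (i' , inject₁ j')) even≡odd)
  where
  even≡odd : 2 * suc (m' * cycleSum i) ≡ suc (2 * label (i' , inject₁ j'))
  even≡odd = trans (sym (cycle-weight-even {m' = m'} p≡2m' i)) (trans eq (path-weight i' j'))
weight-injective _ (m' , p≡2m') {path i j} {cyc i'} eq =
  ⊥-elim (even≢odd (suc (m' * cycleSum i')) (label (i , inject₁ j)) even≡odd)
  where
  even≡odd : 2 * suc (m' * cycleSum i') ≡ suc (2 * label (i , inject₁ j))
  even≡odd = trans (sym (cycle-weight-even {m' = m'} p≡2m' i')) (trans (sym eq) (path-weight i j))
weight-injective _ _ {path i j} {path i' j'} eq =
  cong₂ path (,-injectiveˡ same-lower-end) (inject₁-injective (,-injectiveʳ same-lower-end))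
  where
  same-lower-end : (i , inject₁ j) ≡ (i' , inject₁ j')
  same-lower-end = label-injective (*-cancelˡ-≡ _ _ 2 (suc-injective
    (trans (sym (path-weight i j)) (trans eq (path-weight i' j')))))

theorem7 : (k' q : ℕ) → 3 ≤ suc k' → Odd (suc k') → Even (suc q) →
    HasCanonicalESDSunlet k' q
theorem7 k' q _ k-odd p-even = label , record
  { range     = label-range
  ; injective = label-injective
  ; distinct  = weight-injective k-odd p-even
  }
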